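{- Let $\rho$ be a code retrieving function and $p$ a term. If $sq$ is an infinite potential computation of $(\rho,p)$ and the program part of $sq_n$ is $\mathbf{skip}$ for some $n\in\mathbb N$, then $sq$ is fair.
   Context: Program terms over a state type $\alpha$ are generated by $p::=\mathbf{skip}\mid\mathbf{basic}\,f\mid\mathbf{cjump}\,C\,i\,p\mid\mathbf{while}\,C\,p\,p\mid\mathbf{if}\,C\,p\,p\mid p;p\mid\Vert(p_1,\dots,p_m)\mid\mathbf{await}\,C\,p$ ($f:\alpha\to\alpha$, $C\subseteq\alpha$, $i\in\mathbb N$, $m\ge1$). A code retrieving function $\rho$ maps $\mathbb N$ to terms. The program step relation $\rho\vdash(p,\sigma)\to_{\mathcal P}(p',\sigma')$ is the least relation with: $(\mathbf{basic}\,f,\sigma)\to(\mathbf{skip},f\sigma)$; $(\mathbf{cjump}\,C\,i\,p,\sigma)\to(\rho\,i,\sigma)$ if $\sigma\in C$, $\to(p,\sigma)$ otherwise; $(\mathbf{await}\,C\,p,\sigma)\to(\mathbf{skip},\sigma')$ if $\sigma\in C$ and $(p,\sigma)\to^*(\mathbf{skip},\sigma')$; $(\mathbf{if}\,C\,p_1\,p_2,\sigma)\to(p_1,\sigma)$ if $\sigma\in C$, $\to(p_2,\sigma)$ otherwise; for $x=\mathbf{while}\,C\,p_1\,p_2$: $(x,\sigma)\to(p_1;(\mathbf{skip};x),\sigma)$ if $\sigma\in C$, $\to(p_2,\sigma)$ otherwise; $(p_1;p_2,\sigma)\to(p_1';p_2,\sigma')$ if $(p_1,\sigma)\to(p_1',\sigma')$;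 $(\mathbf{skip};p,\sigma)\to(p,\sigma)$; $(\Vert(\dots,p_i,\dots),\sigma)\to(\Vert(\dots,p_i',\dots),\sigma')$ if $(p_i,\sigma)\to(p_i',\sigma')$; $(\Vert(\mathbf{skip},\dots,\mathbf{skip}),\sigma)\to(\mathbf{skip},\sigma)$. An infinite potential computation of $(\rho,p)$ is a sequence $sq_i=(p_i,\sigma_i)$, $i\in\mathbb N$, with $p_0=p$, each transition labelled as a program step ($\rho\vdash sq_i\to_{\mathcal P}sq_{i+1}$) or an environment step ($p_{i+1}=p_i$, state arbitrary). Positions are finite lists of natural numbers; below $0$ denotes the one-element list $[0]$ and $ix$ the list $x$ with $i$ prepended. The set $\mathrm{Pos}(p)$ is given by the following equations, applied in order: $\mathrm{Pos}(\mathbf{skip})=\emptyset$; $\mathrm{Pos}(\mathbf{skip};q)=\{0\}$; $\mathrm{Pos}(p;q)=\{0x\mid x\in\mathrm{Pos}(p)\}$; $\mathrm{Pos}(\Vert(\mathbf{skip},\dots,\mathbf{skip}))=\{0\}$; $\mathrm{Pos}(\Vert(p_1,\dots,p_m))=\bigcup_{i=1}^m\{ix\mid x\in\mathrm{Pos}(p_i)\}$; $\mathrm{Pos}(p)=\{0\}$ for all other $p$. Subterm at a position: $p|_0=p$, $(p;q)|_{0x}=p|_x$, $\Vert(p_1,\dots,p_m)|_{ix}=p_i|_x$. Replacement: $p[p']_0=p'$, $(p;q)[p']_{0x}=(p[p']_x);q$, $\Vert(p_1,\dots,p_m)[p']_{ix}=\Vert(p_1,\dots,p_i[p']_x,\dots,p_m)$.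 A position $x\in\mathrm{Pos}(p)$ is always available if, whenever $p|_x=\mathbf{await}\,C\,p'$, we have $C=\alpha$ and for every state $\sigma$ there is $\sigma'$ with $\rho\vdash(p',\sigma)\to_{\mathcal P}^*(\mathbf{skip},\sigma')$. An infinite potential computation $sq$ of $(\rho,p)$ is fair if for every $i\in\mathbb N$ and every always available $x\in\mathrm{Pos}(p_i)$ there is $j\ge i$ with $x\in\mathrm{Pos}(p_j)$, $p_j|_x=p_i|_x$, the transition $j\to j+1$ a program step, and some $p'$ with $p_{j+1}=p_j[p']_x$ and $\rho\vdash(p_j|_x,\sigma_j)\to_{\mathcal P}(p',\sigma_{j+1})$. -}

module Defs where

open import Data.Nat using (ℕ; zero; suc; _≥_)
open import Data.Fin using (Fin; toℕ)
open import Data.Vec using (Vec; lookup; _[_]≔_)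
import Data.Vec as Vec
import Data.Maybe
open import Data.Unit using (⊤)
open import Data.Empty using (⊥)
open import Data.Vec.Relation.Unary.All using (All)
open import Data.List using (List; []; _∷_)
open import Data.Maybe using (Maybe; just; nothing)
open import Data.Product using (_×_; _,_; proj₁; proj₂; ∃; ∃-syntax; Σ-syntax)
open import Relation.Nullary using (¬_)
open import Relation.Binary.PropositionalEquality using (_≡_)
open import Relation.Binary.Construct.Closure.ReflexiveTransitive using (Star)

-- Program terms over a state type α.  Subsets C ⊆ α are predicates α → Set.
-- Parallel composition ∥(p₁,…,p_m) with m ≥ 1 is a Vec of length suc m.
data Prog (α : Set) : Set₁ where
  skip  : Prog α
  basic : (α → α) → Prog α
  cjump : (α → Set) → ℕ → Prog α → Prog α
  while : (α → Set) → Prog α → Prog α → Prog α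
  if    : (α → Set) → Prog α → Prog α → Prog α
  _⨾_   : Prog α → Prog α → Prog α
  par   : ∀ {m} → Vec (Prog α) (suc m) → Prog α
  await : (α → Set) → Prog α → Prog α

CodeRet : Set → Set₁
CodeRet α = ℕ → Prog α

Config : Set → Set₁
Config α = Prog α × α

data Step {α : Set} (ρ : CodeRet α) : Config α → Config α → Set₁ where
  basicS   : ∀ f σ → Step ρ (basic f , σ) (skip , f σ)
  cjumpT   : ∀ C i p σ → C σ → Step ρ (cjump C i p , σ) (ρ i , σ)
  cjumpF   : ∀ C i p σ → ¬ C σ → Step ρ (cjump C i p , σ) (p , σ)
  awaitS   : ∀ C p σ σ' → C σ → Star (Step ρ) (p , σ) (skip , σ') →
             Step ρ (await C p , σ) (skip , σ')
  ifT      : ∀ C p₁ p₂ σ → C σ → Step ρ (if C p₁ p₂ , σ) (p₁ , σ)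
  ifF      : ∀ C p₁ p₂ σ → ¬ C σ → Step ρ (if C p₁ p₂ , σ) (p₂ , σ)
  whileT   : ∀ C p₁ p₂ σ → C σ →
             Step ρ (while C p₁ p₂ , σ) (p₁ ⨾ (skip ⨾ while C p₁ p₂) , σ)
  whileF   : ∀ C p₁ p₂ σ → ¬ C σ → Step ρ (while C p₁ p₂ , σ) (p₂ , σ)
  seqS     : ∀ p₁ p₁' p₂ σ σ' → Step ρ (p₁ , σ) (p₁' , σ') →
             Step ρ (p₁ ⨾ p₂ , σ) (p₁' ⨾ p₂ , σ')
  seqSkip  : ∀ p σ → Step ρ (skip ⨾ p , σ) (p , σ)
  parS     : ∀ {m} (ps : Vec (Prog α) (suc m)) (i : Fin (suc m)) p' σ σ' →
             Step ρ (lookup ps i , σ) (p' , σ') →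
             Step ρ (par ps , σ) (par (ps [ i ]≔ p') , σ')
  parSkip  : ∀ {m} (ps : Vec (Prog α) (suc m)) σ → All (_≡ skip) ps →
             Step ρ (par ps , σ) (skip , σ)

Steps : ∀ {α : Set} → CodeRet α → Config α → Config α → Set₁
Steps ρ = Star (Step ρ)

data Transition {α : Set} (ρ : CodeRet α) : Config α → Config α → Set₁ where
  progStep : ∀ {c c'} → Step ρ c c' → Transition ρ c c'
  envStep  : ∀ {p σ σ'} → Transition ρ (p , σ) (p , σ')

IsProgStep : ∀ {α : Set} {ρ : CodeRet α} {c c'} → Transition ρ c c' → Set
IsProgStep (progStep _) = ⊤
IsProgStep envStep      = ⊥

record InfPotComp {α : Set} (ρ : CodeRet α) (p : Prog α) : Set₁ where
  field
    sq    : ℕ → Config α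
    start : proj₁ (sq 0) ≡ p
    trans : ∀ i → Transition ρ (sq i) (sq (suc i))

-- Positions: finite lists of naturals; [0] is the root position.
Pos : Set
Pos = List ℕ

-- "all other p" in the definition of Pos
data Other {α : Set} : Prog α → Set₁ where
  oBasic : ∀ f → Other (basic f)
  oCjump : ∀ C i p → Other (cjump C i p)
  oWhile : ∀ C p q → Other (while C p q)
  oIf    : ∀ C p q → Other (if C p q)
  oAwait : ∀ C p → Other (await C p)

-- x ∈Pos p  iff  x ∈ Pos(p).  (The ordered equations of the paper; the
-- seq / par clauses need no side condition since Pos(skip) = ∅.)
data _∈Pos_ {α : Set} : Pos → Prog α → Set₁ where
  posSeqSkip : ∀ q → (0 ∷ []) ∈Pos (skip ⨾ q)
  posSeq     : ∀ {x p q} → x ∈Pos p → (0 ∷ x) ∈Pos (p ⨾ q)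
  posParSkip : ∀ {m} (ps : Vec (Prog α) (suc m)) → All (_≡ skip) ps →
               (0 ∷ []) ∈Pos par ps
  posPar     : ∀ {m} (ps : Vec (Prog α) (suc m)) (i : Fin (suc m)) {x} →
               x ∈Pos lookup ps i → (suc (toℕ i) ∷ x) ∈Pos par ps
  posOther   : ∀ {p} → Other p → (0 ∷ []) ∈Pos p

-- subterm p|_x (partial) and replacement p[p']_x (partial);
-- parallel components are indexed 1..m.
mutual
  subterm : ∀ {α : Set} → Prog α → Pos → Maybe (Prog α)
  subterm p (0 ∷ []) = just p
  subterm (p ⨾ q) (0 ∷ x@(_ ∷ _)) = subterm p x
  subterm (par ps) (suc i ∷ x) = subtermV ps i x
  subterm _ _ = nothing

  subtermV : ∀ {α : Set} {n} → Vec (Prog α) n → ℕ → Pos → Maybe (Prog α)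
  subtermV Vec.[] _ _ = nothing
  subtermV (p Vec.∷ ps) zero x = subterm p x
  subtermV (p Vec.∷ ps) (suc i) x = subtermV ps i x

mutual
  replace : ∀ {α : Set} → Prog α → Pos → Prog α → Maybe (Prog α)
  replace p (0 ∷ []) p' = just p'
  replace (p ⨾ q) (0 ∷ x@(_ ∷ _)) p' = Data.Maybe.map (_⨾ q) (replace p x p')
  replace (par ps) (suc i ∷ x) p' = Data.Maybe.map par (replaceV ps i x p')
  replace _ _ _ = nothing

  replaceV : ∀ {α : Set} {n} → Vec (Prog α) n → ℕ → Pos → Prog α →
             Maybe (Vec (Prog α) n)
  replaceV Vec.[] _ _ _ = nothing
  replaceV (p Vec.∷ ps) zero x p' = Data.Maybe.map (Vec._∷ ps) (replace p x p')
  replaceV (p Vec.∷ ps) (suc i) x p' = Data.Maybe.map (p Vec.∷_) (replaceV ps i x p')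

AlwaysAvailable : ∀ {α : Set} → CodeRet α → Prog α → Pos → Set₁
AlwaysAvailable {α} ρ p x =
  x ∈Pos p ×
  (∀ C p' → subterm p x ≡ just (await C p') →
     (∀ σ → C σ) × (∀ σ → ∃[ σ' ] Steps ρ (p' , σ) (skip , σ')))

Fair : ∀ {α : Set} {ρ : CodeRet α} {p : Prog α} → InfPotComp ρ p → Set₁
Fair {α} {ρ} c =
  ∀ i x → AlwaysAvailable ρ (proj₁ (sq i)) x →
  ∃[ j ] (j ≥ i ×
    x ∈Pos proj₁ (sq j) ×
    subterm (proj₁ (sq j)) x ≡ subterm (proj₁ (sq i)) x ×
    IsProgStep (trans j) ×
    ∃[ p' ] (replace (proj₁ (sq j)) x p' ≡ just (proj₁ (sq (suc j))) ×
             ∃[ q ] (subterm (proj₁ (sq j)) x ≡ just q ×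
                     Step ρ (q , proj₂ (sq j)) (p' , proj₂ (sq (suc j))))))
  where open InfPotComp c

module Submission where

-- Once a computation reaches skip, every later position set is empty, so a
-- computation that terminates is fair: a position that is present at time i
-- cannot survive until the end, and the only way to lose it is a program step
-- that executes exactly the subterm sitting there.
--
-- This holds for every position, so mainTheorem16 needs nothing
--    from the always-availability hypothesis beyond x ∈ Pos(p_i).

open import Defs
open import Data.Nat using (ℕ; zero; suc; _+_; _≥_)
open import Data.Nat.Properties using (≤-refl; ≤-trans; n≤1+n; +-comm; +-suc)
open import Data.Product using (proj₁; ∃-syntax; _×_; _,_)
open import Data.Sum using (_⊎_; inj₁; inj₂)
import Data.Sum as Sum
open import Data.Empty using (⊥-elim)
open import Data.Unit using (tt)
open import Data.Fin using (Fin; toℕ; _≟_) renaming (zero to fzero; suc to fsuc)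
open import Data.Vec using (Vec; lookup; _[_]≔_)
import Data.Vec as Vec
open import Data.List using ([]; _∷_)
open import Data.Vec.Properties using (lookup∘update; lookup∘update′)
open import Data.Vec.Relation.Unary.All.Properties using (lookup⁺)
open import Data.Maybe using (just)
import Data.Maybe as Maybe
open import Relation.Nullary using (¬_; yes; no)
open import Relation.Binary.PropositionalEquality

skip-has-no-positions : ∀ {α : Set} {x : Pos} → ¬ (x ∈Pos skip {α})
skip-has-no-positions (posOther ())

no-step-from-skip : ∀ {α : Set} {ρ : CodeRet α} {c c' : Config α} →
                    proj₁ c ≡ skip → ¬ Step ρ c c'
no-step-from-skip {c = _ , _} refl ()

-- Every position is a non-empty list; this makes the seq clauses of
-- subterm and replace compute.
position-is-cons : ∀ {α : Set} {x : Pos} {p : Prog α} → x ∈Pos p →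
                   ∃[ a ] ∃[ y ] (x ≡ a ∷ y)
position-is-cons (posSeqSkip _)   = _ , _ , refl
position-is-cons (posSeq _)       = _ , _ , refl
position-is-cons (posParSkip _ _) = _ , _ , refl
position-is-cons (posPar _ _ _)   = _ , _ , refl
position-is-cons (posOther _)     = _ , _ , refl

subterm-seq : ∀ {α : Set} {x : Pos} {p : Prog α} (q : Prog α) → x ∈Pos p →
              subterm (p ⨾ q) (0 ∷ x) ≡ subterm p x
subterm-seq q h with position-is-cons h
... | _ , _ , refl = refl

replace-seq : ∀ {α : Set} {x : Pos} {p : Prog α} (q r : Prog α) → x ∈Pos p →
              replace (p ⨾ q) (0 ∷ x) r ≡ Maybe.map (_⨾ q) (replace p x r)
replace-seq q r h with position-is-cons h
... | _ , _ , refl = refl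

subterm-par : ∀ {α : Set} {n} (ps : Vec (Prog α) n) (k : Fin n) (x : Pos) →
              subtermV ps (toℕ k) x ≡ subterm (lookup ps k) x
subterm-par (_ Vec.∷ _)  fzero    x = refl
subterm-par (_ Vec.∷ ps) (fsuc k) x = subterm-par ps k x

replace-par : ∀ {α : Set} {n} (ps : Vec (Prog α) n) (k : Fin n) (x : Pos)
              (r p' : Prog α) → replace (lookup ps k) x r ≡ just p' →
              replaceV ps (toℕ k) x r ≡ just (ps [ k ]≔ p')
replace-par (_ Vec.∷ _)  fzero    x r p' e rewrite e = refl
replace-par (_ Vec.∷ ps) (fsuc k) x r p' e rewrite replace-par ps k x r p' e = refl

module _ {α : Set} (ρ : CodeRet α) where

  Fires : Config α → Config α → Pos → Set₁
  Fires (p , σ) (p' , σ') x =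
    ∃[ r ] (replace p x r ≡ just p' ×
            ∃[ q ] (subterm p x ≡ just q × Step ρ (q , σ) (r , σ')))

  fires-root : ∀ {c c' : Config α} → Step ρ c c' → Fires c c' (0 ∷ [])
  fires-root s = _ , refl , _ , refl , s

  fires-seq : ∀ {p p' q : Prog α} {σ σ' : α} {x : Pos} → x ∈Pos p →
              Fires (p , σ) (p' , σ') x → Fires (p ⨾ q , σ) (p' ⨾ q , σ') (0 ∷ x)
  fires-seq {q = q} h (r , er , t , et , s) =
    r , trans (replace-seq q r h) (cong (Maybe.map (_⨾ q)) er) ,
    t , trans (subterm-seq q h) et , s

  fires-par : ∀ {m} {ps : Vec (Prog α) (suc m)} {k : Fin (suc m)}
                {p' : Prog α} {σ σ' : α} {x : Pos} →
              Fires (lookup ps k , σ) (p' , σ') x →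
              Fires (par ps , σ) (par (ps [ k ]≔ p') , σ') (suc (toℕ k) ∷ x)
  fires-par {ps = ps} {k} {p'} {x = x} (r , er , t , et , s) =
    r , cong (Maybe.map par) (replace-par ps k x r p' er) ,
    t , trans (subterm-par ps k x) et , s

Preserves : ∀ {α : Set} → Prog α → Prog α → Pos → Set₁
Preserves p p' x = x ∈Pos p' × subterm p' x ≡ subterm p x

preserves-refl : ∀ {α : Set} {p : Prog α} {x : Pos} → x ∈Pos p → Preserves p p x
preserves-refl h = h , refl

preserves-seq : ∀ {α : Set} {p p' : Prog α} (q : Prog α) {x : Pos} → x ∈Pos p →
                Preserves p p' x → Preserves (p ⨾ q) (p' ⨾ q) (0 ∷ x)
preserves-seq q h (h' , e) =
  posSeq h' , trans (subterm-seq q h') (trans e (sym (subterm-seq q h)))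

preserves-par : ∀ {α : Set} {m} (ps ps' : Vec (Prog α) (suc m)) (k : Fin (suc m))
                  {x : Pos} → Preserves (lookup ps k) (lookup ps' k) x →
                Preserves (par ps) (par ps') (suc (toℕ k) ∷ x)
preserves-par ps ps' k {x} (h' , e) =
  posPar ps' k h' ,
  trans (subterm-par ps' k x) (trans e (sym (subterm-par ps k x)))

FiresOrPreserves : ∀ {α : Set} → CodeRet α → Config α → Config α → Pos → Set₁
FiresOrPreserves ρ c c' x = Fires ρ c c' x ⊎ Preserves (proj₁ c) (proj₁ c') x

module _ {α : Set} {ρ : CodeRet α} where

  par-same-component : ∀ {m} (ps : Vec (Prog α) (suc m)) (k : Fin (suc m))
                         {p' : Prog α} {σ σ' : α} {x : Pos} →
                       FiresOrPreserves ρ (lookup ps k , σ) (p' , σ') x →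
                       FiresOrPreserves ρ (par ps , σ) (par (ps [ k ]≔ p') , σ')
                                          (suc (toℕ k) ∷ x)
  par-same-component ps k       (inj₁ fires) = inj₁ (fires-par ρ fires)
  par-same-component ps k {p'} (inj₂ pres) =
    inj₂ (preserves-par ps (ps [ k ]≔ p') k
            (subst (λ r → Preserves (lookup ps k) r _) (sym (lookup∘update k ps p')) pres))

  par-other-component : ∀ {m} (ps : Vec (Prog α) (suc m)) {k i : Fin (suc m)}
                          (p' : Prog α) {x : Pos} → k ≢ i → x ∈Pos lookup ps k →
                        Preserves (par ps) (par (ps [ i ]≔ p')) (suc (toℕ k) ∷ x)
  par-other-component ps {k} {i} p' k≢i h =
    preserves-par ps (ps [ i ]≔ p') k
      (subst (λ r → Preserves (lookup ps k) r _)
             (sym (lookup∘update′ k≢i ps p')) (preserves-refl h))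

  -- Local analysis of one program step: at every position it either fires
  -- or preserves the position.  A root position always fires, since the
  -- whole program is the subterm there.
  fires-or-preserves : ∀ {p p' : Prog α} {σ σ' : α} {x : Pos} → x ∈Pos p →
                       Step ρ (p , σ) (p' , σ') →
                       FiresOrPreserves ρ (p , σ) (p' , σ') x
  fires-or-preserves (posSeqSkip _)   s = inj₁ (fires-root ρ s)
  fires-or-preserves (posParSkip _ _) s = inj₁ (fires-root ρ s)
  fires-or-preserves (posOther _)     s = inj₁ (fires-root ρ s)
  fires-or-preserves (posSeq h) (seqS _ _ q _ _ s) =
    Sum.map (fires-seq ρ h) (preserves-seq q h) (fires-or-preserves h s)
  fires-or-preserves (posSeq h) (seqSkip _ _) = ⊥-elim (skip-has-no-positions h)
  fires-or-preserves (posPar ps k h) (parS _ i p' _ _ s) with k ≟ i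
  ... | yes refl = par-same-component ps k (fires-or-preserves h s)
  ... | no k≢i   = inj₂ (par-other-component ps p' k≢i h)
  fires-or-preserves {x = _ ∷ x} (posPar ps k h) (parSkip _ _ allSkip) =
    ⊥-elim (skip-has-no-positions (subst (x ∈Pos_) (lookup⁺ allSkip k) h))

  transition-fires-or-preserves :
    ∀ {c c' : Config α} {x : Pos} (t : Transition ρ c c') → x ∈Pos proj₁ c →
    (IsProgStep t × Fires ρ c c' x) ⊎ Preserves (proj₁ c) (proj₁ c') x
  transition-fires-or-preserves (progStep s) h =
    Sum.map₁ (tt ,_) (fires-or-preserves h s)
  transition-fires-or-preserves envStep h = inj₂ (preserves-refl h)

  skip-persists : ∀ {c c' : Config α} → Transition ρ c c' →
                  proj₁ c ≡ skip → proj₁ c' ≡ skip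
  skip-persists (progStep s) e = ⊥-elim (no-step-from-skip e s)
  skip-persists envStep      e = e

module _ {α : Set} {ρ : CodeRet α} {p : Prog α} (c : InfPotComp ρ p) where
  open InfPotComp c renaming (trans to transition)

  prog : ℕ → Prog α
  prog i = proj₁ (sq i)

  stays-skip : ∀ n → prog n ≡ skip → ∀ k → prog (k + n) ≡ skip
  stays-skip n e zero    = e
  stays-skip n e (suc k) = skip-persists (transition (k + n)) (stays-skip n e k)

  Served : ℕ → Pos → Set₁
  Served i x = ∃[ j ] (j ≥ i ×
    x ∈Pos prog j ×
    subterm (prog j) x ≡ subterm (prog i) x ×
    IsProgStep (transition j) ×
    Fires ρ (sq j) (sq (suc j)) x)

  served-earlier : ∀ {i x} → subterm (prog (suc i)) x ≡ subterm (prog i) x →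
                   Served (suc i) x → Served i x
  served-earlier e (j , j≥1+i , h , e' , fired) =
    j , ≤-trans (n≤1+n _) j≥1+i , h , trans e' e , fired

  -- Every position is served if skip is reached k steps later: it cannot
  -- be preserved all the way to skip, which has no positions.
  served : ∀ k i {x} → prog (k + i) ≡ skip → x ∈Pos prog i → Served i x
  served zero    i e h = ⊥-elim (skip-has-no-positions (subst (_ ∈Pos_) e h))
  served (suc k) i e h with transition-fires-or-preserves (transition i) h
  ... | inj₁ (isProg , fires) = i , ≤-refl , h , refl , isProg , fires
  ... | inj₂ (h' , e') =
    served-earlier e' (served k (suc i) (subst (λ m → prog m ≡ skip) (sym (+-suc k i)) e) h')

mainTheorem16 : {α : Set} (ρ : CodeRet α) (p : Prog α) (c : InfPotComp ρ p) →
    ∃[ n ] (proj₁ (InfPotComp.sq c n) ≡ skip) → Fair c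
mainTheorem16 ρ p c (n , atSkip) i x (h , _) =
  served c n i (subst (λ m → prog c m ≡ skip) (+-comm i n) (stays-skip c n atSkip i)) h
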